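{- Let $G=(V,E)$ be a simple $2$-vertex-connected graph with at least five vertices, whose vertex set is partitioned into safe and unsafe vertices. Let $C$ be a $4$-cycle of $G$ with vertices $u,w,v,z$ in cyclic order (edges $uw,wv,vz,zu$) such that $\deg_G(w)=\deg_G(z)=2$ and both $u$ and $v$ are unsafe. Then every optimal (minimum-cardinality) feasible FVC solution $F$ for $G$ contains $uw$ and $wv$, and $F\setminus\{uw,wv\}$ is an optimal feasible FVC solution for the instance $G\setminus\{w\}$ (the graph obtained by deleting $w$, with all other vertices keeping their safe/unsafe status).
   Context: An instance consists of a graph $G=(V,E)$ with $V$ partitioned into safe and unsafe vertices. A set $F\subseteq E$ is a feasible FVC solution if $(V,F)$ is connected and no unsafe vertex is a cut-vertex of $(V,F)$; an optimal solution is a feasible FVC solution of minimum cardinality. A $4$-cycle $C$ of $G$ is called a forbidden cycle if it has two vertices $w,z$ with $wz\notin E(C)$ and $\deg_G(w)=\deg_G(z)=2$. -}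

module Defs where

open import Data.Nat using (ℕ; _≤_)
open import Data.Fin using (Fin; _<_)
open import Data.Fin.Properties using () renaming (_≟_ to _≟ᶠ_)
open import Data.Bool using (Bool; T)
open import Data.Product using (_×_; _,_; proj₁; proj₂; ∃₂)
open import Data.Product.Properties using (≡-dec)
open import Data.Sum using (_⊎_)
open import Data.List using (List; length; filter)
open import Data.List.Relation.Unary.All using (All)
open import Data.List.Relation.Unary.Unique.Propositional using (Unique)
open import Data.List.Membership.Propositional using (_∈_)
open import Relation.Binary.PropositionalEquality using (_≡_; _≢_)
open import Relation.Binary.Construct.Closure.ReflexiveTransitive using (Star)
open import Relation.Nullary using (¬_; Dec)
open import Relation.Nullary.Decidable using (_⊎-dec_; ¬?)

-- Vertices are drawn from Fin n; an edge {a,b} is stored as the pair (a , b) with a < b.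
Edge : ℕ → Set
Edge n = Fin n × Fin n

record Graph (n : ℕ) : Set where
  constructor graph
  field
    vs : List (Fin n)
    es : List (Edge n)
open Graph public

Simple : ∀ {n} → Graph n → Set
Simple G = Unique (vs G) × Unique (es G)
         × All (λ e → proj₁ e < proj₂ e) (es G)
         × All (λ e → proj₁ e ∈ vs G × proj₂ e ∈ vs G) (es G)

HasEdge : ∀ {n} → List (Edge n) → Fin n → Fin n → Set
HasEdge F a b = (a , b) ∈ F ⊎ (b , a) ∈ F

Reach : ∀ {n} → List (Edge n) → Fin n → Fin n → Set
Reach F = Star (HasEdge F)

ReachAvoid : ∀ {n} → List (Edge n) → Fin n → Fin n → Fin n → Set
ReachAvoid F x = Star (λ a b → HasEdge F a b × a ≢ x × b ≢ x)

Connected : ∀ {n} → List (Fin n) → List (Edge n) → Set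
Connected V F = ∀ a b → a ∈ V → b ∈ V → Reach F a b

CutVertex : ∀ {n} → List (Fin n) → List (Edge n) → Fin n → Set
CutVertex V F x = x ∈ V × ∃₂ λ a b → a ∈ V × b ∈ V × a ≢ x × b ≢ x × ¬ ReachAvoid F x a b

TwoConnected : ∀ {n} → Graph n → Set
TwoConnected G = 3 ≤ length (vs G) × Connected (vs G) (es G)
               × (∀ x → x ∈ vs G → ¬ CutVertex (vs G) (es G) x)

Incident : ∀ {n} → Fin n → Edge n → Set
Incident v e = proj₁ e ≡ v ⊎ proj₂ e ≡ v

incident? : ∀ {n} (v : Fin n) (e : Edge n) → Dec (Incident v e)
incident? v e = (proj₁ e ≟ᶠ v) ⊎-dec (proj₂ e ≟ᶠ v)

deg : ∀ {n} → Graph n → Fin n → ℕ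
deg G v = length (filter (incident? v) (es G))

UnsafeVertex : ∀ {n} → (Fin n → Bool) → Fin n → Set
UnsafeVertex unsafe v = T (unsafe v)

Feasible : ∀ {n} → Graph n → (Fin n → Bool) → List (Edge n) → Set
Feasible G unsafe F =
  All (_∈ es G) F × Unique F × Connected (vs G) F
  × (∀ x → x ∈ vs G → UnsafeVertex unsafe x → ¬ CutVertex (vs G) F x)

-- optimal = feasible of minimum cardinality (|F| = length F since F is duplicate-free)
Optimal : ∀ {n} → Graph n → (Fin n → Bool) → List (Edge n) → Set
Optimal G unsafe F = Feasible G unsafe F
  × (∀ F′ → Feasible G unsafe F′ → length F ≤ length F′)

deleteVertex : ∀ {n} → Graph n → Fin n → Graph n
deleteVertex G w = graph (filter (λ x → ¬? (x ≟ᶠ w)) (vs G))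
                         (filter (λ e → ¬? (incident? w e)) (es G))

SameEdge : ∀ {n} → Fin n → Fin n → Edge n → Set
SameEdge a b e = e ≡ (a , b) ⊎ e ≡ (b , a)

sameEdge? : ∀ {n} (a b : Fin n) (e : Edge n) → Dec (SameEdge a b e)
sameEdge? a b e = ≡-dec _≟ᶠ_ _≟ᶠ_ e (a , b) ⊎-dec ≡-dec _≟ᶠ_ _≟ᶠ_ e (b , a)

removeEdge : ∀ {n} → Fin n → Fin n → List (Edge n) → List (Edge n)
removeEdge a b F = filter (λ e → ¬? (sameEdge? a b e)) F

{-# OPTIONS --safe #-}

-- If F lacked uw, the unsafe vertex v would separate w from u, since w has no other neighbours;
-- so uw, wv ∈ F, and likewise uz, zv ∈ F. Deleting w with its two edges keeps F feasible: a walk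
-- through w is rerouted along u z v, and when z itself must be avoided, a fifth vertex y supplies
-- the detour, since its walks to u avoiding v and to v avoiding u cannot meet w or z before
-- arriving. Conversely, a solution of G - w plus uw and wv is feasible for G, which gives
-- optimality.

module Submission where

open import Defs
open import Data.Nat using (ℕ; suc; _≤_; _<_; s≤s; s≤s⁻¹)
open import Data.Nat.Properties using (≤-trans; <-≤-trans)
open import Data.Fin using (Fin)
open import Data.Fin.Properties using () renaming (_≟_ to _≟ᶠ_)
open import Data.Bool using (Bool)
open import Data.Product using (_×_; _,_; proj₁; proj₂; ∃)
open import Data.Product.Properties using (≡-dec)
open import Data.Sum using (_⊎_; inj₁; inj₂; [_,_]; swap)
import Data.Sum as Sum
open import Data.Empty using (⊥-elim)
open import Data.Unit using (⊤; tt)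
open import Data.List using (List; []; _∷_; length; filter)
open import Data.List.Properties using (filter-notAll)
open import Data.List.Membership.Propositional using (_∈_; _∉_)
open import Data.List.Membership.Propositional.Properties using (∈-filter⁺; ∈-filter⁻)
open import Data.List.Relation.Unary.Any using (here; there)
import Data.List.Relation.Unary.Any as Any
open import Data.List.Relation.Unary.All using (All; _∷_)
import Data.List.Relation.Unary.All as All
open import Data.List.Relation.Unary.AllPairs using (_∷_)
open import Data.List.Relation.Unary.Unique.Propositional using (Unique)
import Data.List.Relation.Unary.Unique.Propositional.Properties as Unique
open import Effect.Monad using (RawMonad)
open import Function using (_∘_)
open import Level using (0ℓ)
open import Relation.Binary.Definitions using (DecidableEquality)
open import Relation.Binary.PropositionalEquality using (_≡_; _≢_; refl; sym)
open import Relation.Binary.Construct.Closure.ReflexiveTransitive using (Star; ε; _◅_; _◅◅_)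
import Relation.Binary.Construct.Closure.ReflexiveTransitive as Star
open import Relation.Nullary using (¬_; Dec; yes; no)
open import Relation.Nullary.Decidable using (¬?; _⊎-dec_)
open import Relation.Nullary.Negation using (¬¬-Monad)

open RawMonad (¬¬-Monad {0ℓ})

private variable
  n : ℕ
  a b c d p q x : Fin n
  e : Edge n
  E F H : List (Edge n)
  V : List (Fin n)
  P : Fin n → Set

¬¬-pull₂ : {A B C : Set} → (A → B → ¬ ¬ C) → ¬ ¬ (A → B → C)
¬¬-pull₂ f k = k λ a b → ⊥-elim (f a b λ c → k λ _ _ → c)

fresh-element : {A : Set} → DecidableEquality A → (ys : List A) {xs : List A} →
  Unique xs → length ys < length xs → ∃ λ x → x ∈ xs × x ∉ ys
fresh-element {A} _≟_ ys {x ∷ xs} (x∉xs ∷ xs-unique) ys<xs with Any.any? (x ≟_) ys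
... | no x∉ys = x , here refl , x∉ys
... | yes x∈ys =
  let y , y∈xs , y∉ys-x = fresh-element _≟_ ys-x xs-unique (<-≤-trans ys-x<ys (s≤s⁻¹ ys<xs))
  in y , there y∈xs , λ y∈ys → y∉ys-x (∈-filter⁺ (¬? ∘ (_≟ x)) y∈ys λ y≡x → All.lookup x∉xs y∈xs (sym y≡x))
  where
  ys-x : List A
  ys-x = filter (¬? ∘ (_≟ x)) ys
  ys-x<ys : length ys-x < length ys
  ys-x<ys = filter-notAll (¬? ∘ (_≟ x)) ys (Any.map (λ x≡y y≢x → y≢x (sym x≡y)) x∈ys)

∈-length-two : {A : Set} {xs : List A} {x y z : A} →
  length xs ≡ 2 → x ≢ y → x ∈ xs → y ∈ xs → z ∈ xs → z ≡ x ⊎ z ≡ y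
∈-length-two {xs = _ ∷ _ ∷ []} _ x≢y (here refl) (here refl) _ = ⊥-elim (x≢y refl)
∈-length-two {xs = _ ∷ _ ∷ []} _ _ (here refl) (there (here refl)) (here refl) = inj₁ refl
∈-length-two {xs = _ ∷ _ ∷ []} _ _ (here refl) (there (here refl)) (there (here refl)) = inj₂ refl
∈-length-two {xs = _ ∷ _ ∷ []} _ _ (there (here refl)) (here refl) (here refl) = inj₂ refl
∈-length-two {xs = _ ∷ _ ∷ []} _ _ (there (here refl)) (here refl) (there (here refl)) = inj₁ refl
∈-length-two {xs = _ ∷ _ ∷ []} _ x≢y (there (here refl)) (there (here refl)) _ = ⊥-elim (x≢y refl)

_≟ₑ_ : DecidableEquality (Edge n)
_≟ₑ_ = ≡-dec _≟ᶠ_ _≟ᶠ_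

hasEdge? : (F : List (Edge n)) (a b : Fin n) → Dec (HasEdge F a b)
hasEdge? F a b = Any.any? ((a , b) ≟ₑ_) F ⊎-dec Any.any? ((b , a) ≟ₑ_) F

HasEdge-sym : HasEdge F a b → HasEdge F b a
HasEdge-sym = swap

HasEdge-⊆ : All (_∈ E) F → HasEdge F a b → HasEdge E a b
HasEdge-⊆ F⊆E = Sum.map (All.lookup F⊆E) (All.lookup F⊆E)

SameEdge⇒HasEdge : e ∈ F → SameEdge a b e → HasEdge F a b
SameEdge⇒HasEdge e∈F (inj₁ refl) = inj₁ e∈F
SameEdge⇒HasEdge e∈F (inj₂ refl) = inj₂ e∈F

HasEdge⇒SameEdge : HasEdge F a b → ∃ λ e → e ∈ F × SameEdge a b e
HasEdge⇒SameEdge (inj₁ ab∈F) = _ , ab∈F , inj₁ refl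
HasEdge⇒SameEdge (inj₂ ba∈F) = _ , ba∈F , inj₂ refl

SameEdge-incidentˡ : SameEdge a b e → Incident a e
SameEdge-incidentˡ (inj₁ refl) = inj₁ refl
SameEdge-incidentˡ (inj₂ refl) = inj₂ refl

SameEdge-incidentʳ : SameEdge a b e → Incident b e
SameEdge-incidentʳ = SameEdge-incidentˡ ∘ swap

SameEdge-injective : SameEdge p a e → SameEdge p b e → a ≡ b
SameEdge-injective (inj₁ refl) (inj₁ refl) = refl
SameEdge-injective (inj₁ refl) (inj₂ refl) = refl
SameEdge-injective (inj₂ refl) (inj₁ refl) = refl
SameEdge-injective (inj₂ refl) (inj₂ refl) = refl

Walk : List (Edge n) → (Fin n → Set) → Fin n → Fin n → Set
Walk F P = Star λ a b → HasEdge F a b × P a × P b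

Walk-reverse : Walk F P a b → Walk F P b a
Walk-reverse = Star.reverse λ (ab , pa , pb) → HasEdge-sym ab , pb , pa

Walk-⊆ : All (_∈ H) F → Walk F P a b → Walk H P a b
Walk-⊆ F⊆H = Star.map λ (ab , pa , pb) → HasEdge-⊆ F⊆H ab , pa , pb

Reach⇒Walk : Reach F a b → Walk F (λ _ → ⊤) a b
Reach⇒Walk = Star.map (_, tt , tt)

Walk⇒Reach : Walk F P a b → Reach F a b
Walk⇒Reach = Star.map proj₁

noCut⇒¬¬reachAvoid : ¬ CutVertex V F x → x ∈ V → a ∈ V → b ∈ V → a ≢ x → b ≢ x →
  ¬ ¬ ReachAvoid F x a b
noCut⇒¬¬reachAvoid noCut x∈V a∈V b∈V a≢x b≢x ¬walk =
  noCut (x∈V , _ , _ , a∈V , b∈V , a≢x , b≢x , ¬walk)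

¬¬reachAvoid⇒noCut : (∀ {a b} → a ∈ V → b ∈ V → a ≢ x → b ≢ x → ¬ ¬ ReachAvoid F x a b) →
  ¬ CutVertex V F x
¬¬reachAvoid⇒noCut joined (_ , _ , _ , a∈V , b∈V , a≢x , b≢x , ¬walk) = joined a∈V b∈V a≢x b≢x ¬walk

NeighboursAmong : List (Edge n) → Fin n → Fin n → Fin n → Set
NeighboursAmong E p a b = ∀ {d} → HasEdge E p d → d ≡ a ⊎ d ≡ b

degree-two-neighbours : (G : Graph n) → deg G p ≡ 2 → a ≢ b →
  HasEdge (es G) p a → HasEdge (es G) p b → NeighboursAmong (es G) p a b
degree-two-neighbours {p = p} G deg≡2 a≢b pa pb pd
  with HasEdge⇒SameEdge pa | HasEdge⇒SameEdge pb | HasEdge⇒SameEdge pd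
... | eₐ , eₐ∈E , pa≈eₐ | e_b , e_b∈E , pb≈e_b | e_d , e_d∈E , pd≈e_d =
  Sum.map (λ { refl → SameEdge-injective pd≈e_d pa≈eₐ }) (λ { refl → SameEdge-injective pd≈e_d pb≈e_b })
    (∈-length-two deg≡2 eₐ≢e_b (at-p eₐ∈E pa≈eₐ) (at-p e_b∈E pb≈e_b) (at-p e_d∈E pd≈e_d))
  where
  at-p : e ∈ es G → SameEdge p d e → e ∈ filter (incident? p) (es G)
  at-p e∈E p≈e = ∈-filter⁺ (incident? p) e∈E (SameEdge-incidentˡ p≈e)
  eₐ≢e_b : eₐ ≢ e_b
  eₐ≢e_b refl = a≢b (SameEdge-injective pa≈eₐ pb≈e_b)

not-adjacent : All (_∈ E) F → NeighboursAmong E p a b → c ≢ a → c ≢ b → HasEdge F c d → d ≢ p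
not-adjacent F⊆E p-nbrs c≢a c≢b cd refl = [ c≢a , c≢b ] (p-nbrs (HasEdge-⊆ F⊆E (HasEdge-sym cd)))

-- If ap were missing, b would separate p from a: the only other edge at p leads to b.
edge-forced : All (_∈ E) F → NeighboursAmong E p a b → a ∈ V → b ∈ V → p ∈ V →
  a ≢ b → a ≢ p → b ≢ p → ¬ CutVertex V F b → HasEdge F a p
edge-forced {F = F} {p = p} {a = a} {b = b} F⊆E p-nbrs a∈V b∈V p∈V a≢b a≢p b≢p b-noCut
  with hasEdge? F a p
... | yes ap = ap
... | no ¬ap = ⊥-elim (noCut⇒¬¬reachAvoid b-noCut b∈V p∈V a∈V (b≢p ∘ sym) a≢b (stuck refl))
  where
  stuck : c ≡ p → ¬ ReachAvoid F b c a
  stuck c≡p ε = a≢p c≡p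
  stuck refl ((pd , _ , d≢b) ◅ _) with p-nbrs (HasEdge-⊆ F⊆E pd)
  ... | inj₁ refl = ¬ap (HasEdge-sym pd)
  ... | inj₂ refl = d≢b refl

forcedEdges : All (_∈ E) F → NeighboursAmong E p a b → a ∈ V → b ∈ V → p ∈ V →
  a ≢ b → a ≢ p → b ≢ p → ¬ CutVertex V F a → ¬ CutVertex V F b →
  HasEdge F a p × HasEdge F p b
forcedEdges F⊆E p-nbrs a∈V b∈V p∈V a≢b a≢p b≢p a-noCut b-noCut =
  edge-forced F⊆E p-nbrs a∈V b∈V p∈V a≢b a≢p b≢p b-noCut ,
  HasEdge-sym (edge-forced F⊆E (swap ∘ p-nbrs) b∈V a∈V p∈V (a≢b ∘ sym) b≢p a≢p a-noCut)

module Suppression {n} (G : Graph n) {u w v : Fin n} (u∈V : u ∈ vs G) (v∈V : v ∈ vs G)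
  (u≢w : u ≢ w) (w≢v : w ≢ v) (u≢v : u ≢ v) where

  V′ : List (Fin n)
  V′ = vs (deleteVertex G w)

  E′ : List (Edge n)
  E′ = es (deleteVertex G w)

  ∈V′⁺ : x ∈ vs G → x ≢ w → x ∈ V′
  ∈V′⁺ = ∈-filter⁺ (λ x → ¬? (x ≟ᶠ w))

  ∈V′⁻ : x ∈ V′ → x ∈ vs G × x ≢ w
  ∈V′⁻ = ∈-filter⁻ (λ x → ¬? (x ≟ᶠ w))

  ∈E′⁻ : e ∈ E′ → e ∈ es G × ¬ Incident w e
  ∈E′⁻ = ∈-filter⁻ (λ e → ¬? (incident? w e)) {xs = es G}

  HasEdge-E′-avoids-w : HasEdge E′ a b → a ≢ w × b ≢ w
  HasEdge-E′-avoids-w (inj₁ ab∈E′) = proj₂ (∈E′⁻ ab∈E′) ∘ inj₁ , proj₂ (∈E′⁻ ab∈E′) ∘ inj₂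
  HasEdge-E′-avoids-w (inj₂ ba∈E′) = proj₂ (∈E′⁻ ba∈E′) ∘ inj₂ , proj₂ (∈E′⁻ ba∈E′) ∘ inj₁

  u-or-v-other-than : ∃ λ t → (t ≡ u ⊎ t ≡ v) × t ≢ x
  u-or-v-other-than {x = x} with x ≟ᶠ u
  ... | yes refl = v , inj₂ refl , u≢v ∘ sym
  ... | no x≢u = u , inj₁ refl , x≢u ∘ sym

  module Extension {H : List (Edge n)} {e₁ e₂ : Edge n}
    (e₁∈E : e₁ ∈ es G) (uw≈e₁ : SameEdge u w e₁) (e₂∈E : e₂ ∈ es G) (wv≈e₂ : SameEdge w v e₂)
    {unsafe : Fin n → Bool} (H-feasible : Feasible (deleteVertex G w) unsafe H)
    where

    H⊆E′ : All (_∈ E′) H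
    H⊆E′ = proj₁ H-feasible

    H-unique : Unique H
    H-unique = proj₁ (proj₂ H-feasible)

    H-connected : Connected V′ H
    H-connected = proj₁ (proj₂ (proj₂ H-feasible))

    H-noCut : ∀ x → x ∈ V′ → UnsafeVertex unsafe x → ¬ CutVertex V′ H x
    H-noCut = proj₂ (proj₂ (proj₂ H-feasible))

    H⁺ : List (Edge n)
    H⁺ = e₁ ∷ e₂ ∷ H

    H⊆H⁺ : All (_∈ H⁺) H
    H⊆H⁺ = All.tabulate (there ∘ there)

    wu∈H⁺ : HasEdge H⁺ w u
    wu∈H⁺ = HasEdge-sym (SameEdge⇒HasEdge (here refl) uw≈e₁)

    wv∈H⁺ : HasEdge H⁺ w v
    wv∈H⁺ = SameEdge⇒HasEdge (there (here refl)) wv≈e₂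

    at-w⇒∉H : Incident w e → All (e ≢_) H
    at-w⇒∉H w∈e = All.tabulate λ { e′∈H refl → proj₂ (∈E′⁻ (All.lookup H⊆E′ e′∈H)) w∈e }

    H⁺-unique : Unique H⁺
    H⁺-unique = (e₁≢e₂ ∷ at-w⇒∉H (SameEdge-incidentʳ uw≈e₁)) ∷ at-w⇒∉H (SameEdge-incidentˡ wv≈e₂) ∷ H-unique
      where
      e₁≢e₂ : e₁ ≢ e₂
      e₁≢e₂ refl = u≢v (SameEdge-injective (swap uw≈e₁) wv≈e₂)

    reach-u : c ∈ vs G → Reach H⁺ c u
    reach-u {c = c} c∈V with c ≟ᶠ w
    ... | yes refl = wu∈H⁺ ◅ ε
    ... | no c≢w = Walk⇒Reach (Walk-⊆ H⊆H⁺ (Reach⇒Walk (H-connected c u (∈V′⁺ c∈V c≢w) (∈V′⁺ u∈V u≢w))))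

    H⁺-connected : Connected (vs G) H⁺
    H⁺-connected a b a∈V b∈V = reach-u a∈V ◅◅ Star.reverse HasEdge-sym (reach-u b∈V)

    w-neighbour : c ≡ u ⊎ c ≡ v → c ∈ vs G × c ≢ w × HasEdge H⁺ w c
    w-neighbour (inj₁ refl) = u∈V , u≢w , wu∈H⁺
    w-neighbour (inj₂ refl) = v∈V , w≢v ∘ sym , wv∈H⁺

    reachAvoid-neighbour : x ∈ V′ → UnsafeVertex unsafe x → c ≡ u ⊎ c ≡ v → c ≢ x →
      a ∈ vs G → a ≢ x → ¬ ¬ ReachAvoid H⁺ x a c
    reachAvoid-neighbour {a = a} x∈V′ x-unsafe c-nbr c≢x a∈V a≢x with w-neighbour c-nbr | a ≟ᶠ w
    ... | _ , _ , wc | yes refl = pure ((wc , a≢x , c≢x) ◅ ε)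
    ... | c∈V , c≢w , _ | no a≢w = Walk-⊆ H⊆H⁺ <$>
          noCut⇒¬¬reachAvoid (H-noCut _ x∈V′ x-unsafe) x∈V′ (∈V′⁺ a∈V a≢w) (∈V′⁺ c∈V c≢w) a≢x c≢x

    H⁺-noCut : ∀ x → x ∈ vs G → UnsafeVertex unsafe x → ¬ CutVertex (vs G) H⁺ x
    H⁺-noCut x x∈V x-unsafe with x ≟ᶠ w | u-or-v-other-than {x = x}
    ... | yes refl | _ = ¬¬reachAvoid⇒noCut λ a∈V b∈V a≢w b≢w →
          pure (Star.map (λ ab → HasEdge-⊆ H⊆H⁺ ab , HasEdge-E′-avoids-w (HasEdge-⊆ H⊆E′ ab))
                  (H-connected _ _ (∈V′⁺ a∈V a≢w) (∈V′⁺ b∈V b≢w)))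
    ... | no x≢w | t , t-nbr , t≢x = ¬¬reachAvoid⇒noCut λ a∈V b∈V a≢x b≢x → do
          a⇝t ← reachAvoid-neighbour (∈V′⁺ x∈V x≢w) x-unsafe t-nbr t≢x a∈V a≢x
          b⇝t ← reachAvoid-neighbour (∈V′⁺ x∈V x≢w) x-unsafe t-nbr t≢x b∈V b≢x
          pure (a⇝t ◅◅ Walk-reverse b⇝t)

    H⁺-feasible : Feasible G unsafe H⁺
    H⁺-feasible = (e₁∈E ∷ e₂∈E ∷ All.map (proj₁ ∘ ∈E′⁻) H⊆E′) , H⁺-unique , H⁺-connected , H⁺-noCut

  module Reduction (w-nbrs : NeighboursAmong (es G) w u v)
    {F : List (Edge n)} (F⊆E : All (_∈ es G) F) where

    F′ : List (Edge n)
    F′ = removeEdge w v (removeEdge u w F)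

    ∈F′⁺ : e ∈ F → ¬ SameEdge u w e → ¬ SameEdge w v e → e ∈ F′
    ∈F′⁺ e∈F ¬uw ¬wv = ∈-filter⁺ (¬? ∘ sameEdge? w v) (∈-filter⁺ (¬? ∘ sameEdge? u w) e∈F ¬uw) ¬wv

    ∈F′⁻ : e ∈ F′ → e ∈ F × ¬ SameEdge u w e × ¬ SameEdge w v e
    ∈F′⁻ e∈F′ =
      let e∈F-uw , ¬wv = ∈-filter⁻ (¬? ∘ sameEdge? w v) e∈F′
          e∈F , ¬uw = ∈-filter⁻ (¬? ∘ sameEdge? u w) e∈F-uw
      in e∈F , ¬uw , ¬wv

    incident-w : e ∈ es G → Incident w e → SameEdge u w e ⊎ SameEdge w v e
    incident-w {e = _ , _} e∈E (inj₁ refl) with w-nbrs (inj₁ e∈E)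
    ... | inj₁ refl = inj₁ (inj₂ refl)
    ... | inj₂ refl = inj₂ (inj₁ refl)
    incident-w {e = _ , _} e∈E (inj₂ refl) with w-nbrs (inj₂ e∈E)
    ... | inj₁ refl = inj₁ (inj₁ refl)
    ... | inj₂ refl = inj₂ (inj₂ refl)

    F′⊆E′ : All (_∈ E′) F′
    F′⊆E′ = All.tabulate λ e∈F′ →
      let e∈F , ¬uw , ¬wv = ∈F′⁻ e∈F′
          e∈E = All.lookup F⊆E e∈F
      in ∈-filter⁺ (λ e → ¬? (incident? w e)) e∈E ([ ¬uw , ¬wv ] ∘ incident-w e∈E)

    keep : HasEdge F a b → a ≢ w → b ≢ w → HasEdge F′ a b
    keep (inj₁ ab∈F) a≢w b≢w = inj₁ (∈F′⁺ ab∈F (λ uw → [ a≢w , b≢w ] (SameEdge-incidentʳ uw))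
                                                (λ wv → [ a≢w , b≢w ] (SameEdge-incidentˡ wv)))
    keep (inj₂ ba∈F) a≢w b≢w = HasEdge-sym (keep (inj₁ ba∈F) b≢w a≢w)

    -- A detour through w enters and leaves it via u or v, so it is replaced by the u–v walk.
    walk-suppress : (P u → P v → Walk F′ P u v) → a ≢ w → b ≢ w → Walk F P a b → Walk F′ P a b
    walk-suppress bypass a≢w b≢w ε = ε
    walk-suppress {P = P} bypass a≢w b≢w (_◅_ {j = c} (ac , pa , pc) rest) with c ≟ᶠ w
    ... | no c≢w = (keep ac a≢w c≢w , pa , pc) ◅ walk-suppress bypass c≢w b≢w rest
    ... | yes refl with rest
    ...   | ε = ⊥-elim (b≢w refl)
    ...   | _◅_ {j = d} (wd , _ , pd) rest′ =
      detour (w-nbrs (HasEdge-⊆ F⊆E (HasEdge-sym ac))) d-nbr pa pd ◅◅ walk-suppress bypass d≢w b≢w rest′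
      where
      detour : p ≡ u ⊎ p ≡ v → q ≡ u ⊎ q ≡ v → P p → P q → Walk F′ P p q
      detour (inj₁ refl) (inj₁ refl) _ _ = ε
      detour (inj₁ refl) (inj₂ refl) pu pv = bypass pu pv
      detour (inj₂ refl) (inj₁ refl) pv pu = Walk-reverse (bypass pu pv)
      detour (inj₂ refl) (inj₂ refl) _ _ = ε
      d-nbr : d ≡ u ⊎ d ≡ v
      d-nbr = w-nbrs (HasEdge-⊆ F⊆E wd)
      d≢w : d ≢ w
      d≢w = [ (λ { refl → u≢w }) , (λ { refl → w≢v ∘ sym }) ] d-nbr

    feasible-suppressed : {unsafe : Fin n → Bool} → Feasible G unsafe F → Reach F′ u v →
      (∀ {x} → u ≢ x → v ≢ x → ¬ ¬ ReachAvoid F′ x u v) → Feasible (deleteVertex G w) unsafe F′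
    feasible-suppressed {unsafe} (_ , F-unique , F-connected , F-noCut) u⇝v bypass =
      F′⊆E′ , Unique.filter⁺ _ (Unique.filter⁺ _ F-unique) , connected , noCut
      where
      connected : Connected V′ F′
      connected a b a∈V′ b∈V′ =
        let a∈V , a≢w = ∈V′⁻ a∈V′
            b∈V , b≢w = ∈V′⁻ b∈V′
        in Walk⇒Reach (walk-suppress (λ _ _ → Reach⇒Walk u⇝v) a≢w b≢w
                                     (Reach⇒Walk (F-connected a b a∈V b∈V)))

      noCut : ∀ x → x ∈ V′ → UnsafeVertex unsafe x → ¬ CutVertex V′ F′ x
      noCut x x∈V′ x-unsafe = ¬¬reachAvoid⇒noCut λ a∈V′ b∈V′ a≢x b≢x → do
        let x∈V , _ = ∈V′⁻ x∈V′
            a∈V , a≢w = ∈V′⁻ a∈V′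
            b∈V , b≢w = ∈V′⁻ b∈V′
        walk ← noCut⇒¬¬reachAvoid (F-noCut x x∈V x-unsafe) x∈V a∈V b∈V a≢x b≢x
        detour ← ¬¬-pull₂ bypass
        pure (walk-suppress detour a≢w b≢w walk)

    F′-shorter : {e₁ e₂ : Edge n} → e₁ ∈ F → SameEdge u w e₁ → e₂ ∈ F → SameEdge w v e₂ →
      suc (suc (length F′)) ≤ length F
    F′-shorter {e₂ = e₂} e₁∈F uw≈e₁ e₂∈F wv≈e₂ =
      ≤-trans (s≤s (filter-notAll (¬? ∘ sameEdge? w v) _ (Any.map (λ { refl ¬wv → ¬wv wv≈e₂ }) e₂∈F-uw)))
              (filter-notAll (¬? ∘ sameEdge? u w) F (Any.map (λ { refl ¬uw → ¬uw uw≈e₁ }) e₁∈F))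
      where
      e₂∈F-uw : e₂ ∈ removeEdge u w F
      e₂∈F-uw = ∈-filter⁺ (¬? ∘ sameEdge? u w) e₂∈F λ uw≈e₂ → u≢v (SameEdge-injective (swap uw≈e₂) wv≈e₂)

    optimal-suppressed : {unsafe : Fin n → Bool} → Optimal G unsafe F →
      HasEdge F u w → HasEdge F w v → Reach F′ u v →
      (∀ {x} → u ≢ x → v ≢ x → ¬ ¬ ReachAvoid F′ x u v) → Optimal (deleteVertex G w) unsafe F′
    optimal-suppressed {unsafe} (F-feasible , F-minimal) uw∈F wv∈F u⇝v bypass =
      feasible-suppressed F-feasible u⇝v bypass , minimal
      where
      minimal : ∀ H → Feasible (deleteVertex G w) unsafe H → length F′ ≤ length H
      minimal H H-feasible with HasEdge⇒SameEdge uw∈F | HasEdge⇒SameEdge wv∈F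
      ... | e₁ , e₁∈F , uw≈e₁ | e₂ , e₂∈F , wv≈e₂ =
        s≤s⁻¹ (s≤s⁻¹ (≤-trans (F′-shorter e₁∈F uw≈e₁ e₂∈F wv≈e₂)
          (F-minimal _ (Extension.H⁺-feasible (All.lookup F⊆E e₁∈F) uw≈e₁ (All.lookup F⊆E e₂∈F) wv≈e₂ H-feasible))))

    module _ {z : Fin n} (z-nbrs : NeighboursAmong (es G) z u v) where

      -- Until the walk first reaches p, it stays outside {u, v}, hence away from w and z.
      first-arrival : (∀ {c} → c ≢ p → c ≢ q → c ≢ u × c ≢ v) →
        c ≢ w → c ≢ z → ReachAvoid F q c p → ReachAvoid F′ z c p
      first-arrival uv⊆pq c≢w c≢z ε = ε
      first-arrival {p = p} uv⊆pq c≢w c≢z (_◅_ {i = c} (cd , c≢q , d≢q) rest) with c ≟ᶠ p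
      ... | yes refl = ε
      ... | no c≢p =
        let c≢u , c≢v = uv⊆pq c≢p c≢q
            d≢w = not-adjacent F⊆E w-nbrs c≢u c≢v cd
            d≢z = not-adjacent F⊆E z-nbrs c≢u c≢v cd
        in (keep cd c≢w d≢w , c≢z , d≢z) ◅ first-arrival uv⊆pq d≢w d≢z rest

      reachAvoid-around : ¬ CutVertex (vs G) F u → ¬ CutVertex (vs G) F v →
        {y : Fin n} → y ∈ vs G → y ≢ u → y ≢ w → y ≢ v → y ≢ z → ¬ ¬ ReachAvoid F′ z u v
      reachAvoid-around u-noCut v-noCut y∈V y≢u y≢w y≢v y≢z = do
        y⇝u ← noCut⇒¬¬reachAvoid v-noCut v∈V y∈V u∈V y≢v u≢v
        y⇝v ← noCut⇒¬¬reachAvoid u-noCut u∈V y∈V v∈V y≢u (u≢v ∘ sym)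
        pure (Walk-reverse (first-arrival (λ c≢u c≢v → c≢u , c≢v) y≢w y≢z y⇝u)
              ◅◅ first-arrival (λ c≢v c≢u → c≢u , c≢v) y≢w y≢z y⇝v)

mainTheorem2 : ∀ {n} (G : Graph n) (unsafe : Fin n → Bool) →
    Simple G → TwoConnected G → 5 ≤ length (vs G) →
    (u w v z : Fin n) →
    u ∈ vs G → w ∈ vs G → v ∈ vs G → z ∈ vs G →
    u ≢ w → u ≢ v → u ≢ z → w ≢ v → w ≢ z → v ≢ z →
    HasEdge (es G) u w → HasEdge (es G) w v → HasEdge (es G) v z → HasEdge (es G) z u →
    deg G w ≡ 2 → deg G z ≡ 2 →
    UnsafeVertex unsafe u → UnsafeVertex unsafe v →
    (F : List (Edge n)) → Optimal G unsafe F →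
    HasEdge F u w × HasEdge F w v
    × Optimal (deleteVertex G w) unsafe (removeEdge w v (removeEdge u w F))
mainTheorem2 {n} G unsafe simple _ five u w v z u∈V w∈V v∈V z∈V u≢w u≢v u≢z w≢v w≢z v≢z
             uw∈E wv∈E vz∈E zu∈E deg-w deg-z u-unsafe v-unsafe F F-optimal =
  uw∈F , wv∈F , optimal-suppressed F-optimal uw∈F wv∈F (uz∈F′ ◅ zv∈F′ ◅ ε) bypass
  where
  F⊆E : All (_∈ es G) F
  F⊆E = proj₁ (proj₁ F-optimal)

  u-noCut : ¬ CutVertex (vs G) F u
  u-noCut = proj₂ (proj₂ (proj₂ (proj₁ F-optimal))) u u∈V u-unsafe

  v-noCut : ¬ CutVertex (vs G) F v
  v-noCut = proj₂ (proj₂ (proj₂ (proj₁ F-optimal))) v v∈V v-unsafe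

  w-nbrs : NeighboursAmong (es G) w u v
  w-nbrs = degree-two-neighbours G deg-w u≢v (HasEdge-sym uw∈E) wv∈E

  z-nbrs : NeighboursAmong (es G) z u v
  z-nbrs = degree-two-neighbours G deg-z u≢v zu∈E (HasEdge-sym vz∈E)

  w-edges : HasEdge F u w × HasEdge F w v
  w-edges = forcedEdges F⊆E w-nbrs u∈V v∈V w∈V u≢v u≢w (w≢v ∘ sym) u-noCut v-noCut

  z-edges : HasEdge F u z × HasEdge F z v
  z-edges = forcedEdges F⊆E z-nbrs u∈V v∈V z∈V u≢v u≢z v≢z u-noCut v-noCut

  uw∈F : HasEdge F u w
  uw∈F = proj₁ w-edges

  wv∈F : HasEdge F w v
  wv∈F = proj₂ w-edges

  open Suppression G u∈V v∈V u≢w w≢v u≢v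
  open Reduction w-nbrs F⊆E

  uz∈F′ : HasEdge F′ u z
  uz∈F′ = keep (proj₁ z-edges) u≢w (w≢z ∘ sym)

  zv∈F′ : HasEdge F′ z v
  zv∈F′ = keep (proj₂ z-edges) (w≢z ∘ sym) (w≢v ∘ sym)

  bypass : {x : Fin n} → u ≢ x → v ≢ x → ¬ ¬ ReachAvoid F′ x u v
  bypass {x} u≢x v≢x with z ≟ᶠ x | fresh-element _≟ᶠ_ (u ∷ w ∷ v ∷ z ∷ []) (proj₁ simple) five
  ... | no z≢x | _ = pure ((uz∈F′ , u≢x , z≢x) ◅ (zv∈F′ , z≢x , v≢x) ◅ ε)
  ... | yes refl | y , y∈V , y∉uwvz = reachAvoid-around z-nbrs u-noCut v-noCut y∈V
    (y∉uwvz ∘ here) (y∉uwvz ∘ there ∘ here) (y∉uwvz ∘ there ∘ there ∘ here) (y∉uwvz ∘ there ∘ there ∘ there ∘ here)
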